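{- Let $Z$ be a set, let $\mathcal{Y}\subseteq\mathcal{P}(Z)$ be closed under finite unions, and let $\mu:\mathcal{Y}\to\mathcal{P}(Z)$ satisfy $(\mu\subseteq)$ and $(\mu PR)$. Let $A,U,U',Y\in\mathcal{Y}$ and $A_i\in\mathcal{Y}$ for $i\in I$. Then: (1) if $A=\bigcup\{A_i:i\in I\}$, then $\mu(A)\subseteq\bigcup\{\mu(A_i):i\in I\}$; (2) $U\subseteq H(U)$, and $U\subseteq U'$ implies $H(U)\subseteq H(U')$; (3) $\mu(U\cup Y)-H(U)\subseteq\mu(Y)$. If in addition $\mu$ satisfies $(\mu CUM)$, then also: (4) $U\subseteq A$ and $\mu(A)\subseteq H(U)$ imply $\mu(A)\subseteq U$; (5) $\mu(Y)\subseteq H(U)$ implies $Y\subseteq H(U)$ and $\mu(U\cup Y)=\mu(U)$; (6) if $x\in\mu(U)$ and $x\in Y-\mu(Y)$, then $Y\not\subseteq H(U)$; (7) $Y\not\subseteq H(U)$ implies $\mu(U\cup Y)\not\subseteq H(U)$.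
   Context: For all $X,Y\in\mathcal{Y}$: $(\mu\subseteq)$ $\mu(X)\subseteq X$; $(\mu PR)$ $X\subseteq Y\Rightarrow\mu(Y)\cap X\subseteq\mu(X)$; $(\mu CUM)$ $\mu(X)\subseteq Y\subseteq X\Rightarrow\mu(Y)=\mu(X)$. For $U\in\mathcal{Y}$, $H(U):=\bigcup\{X\in\mathcal{Y}:\mu(X)\subseteq U\}$. -}

module Defs where

open import Level using (Level; 0ℓ) renaming (suc to lsuc)
open import Data.Product using (Σ; _×_; ∃)
open import Relation.Unary using (Pred; _⊆_; _≐_; _∪_; _∈_)

-- Subsets of Z are predicates Z → Set; a family 𝒴 ⊆ 𝒫(Z) is a predicate on subsets.
Sub : Set → Set₁
Sub Z = Pred Z 0ℓ

Fam : Set → Set₂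
Fam Z = Pred (Sub Z) (lsuc 0ℓ)

-- 𝒴 is a family of *sets*: membership does not depend on the presentation
-- of a subset as a predicate (extensional equality ≐).
FamExt : {Z : Set} → Fam Z → Set₁
FamExt {Z} 𝒴 = ∀ (X X′ : Sub Z) → X ≐ X′ → 𝒴 X → 𝒴 X′

-- 𝒴 is closed under (binary, hence nonempty finite) unions.
UnionClosed : {Z : Set} → Fam Z → Set₁
UnionClosed {Z} 𝒴 = ∀ (X Y : Sub Z) → 𝒴 X → 𝒴 Y → 𝒴 (X ∪ Y)

-- μ is a function on sets (of 𝒴): it respects extensional equality.
μExt : {Z : Set} → Fam Z → (Sub Z → Sub Z) → Set₁
μExt {Z} 𝒴 μ = ∀ (X X′ : Sub Z) → 𝒴 X → 𝒴 X′ → X ≐ X′ → μ X ⊆ μ X′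

μSub : {Z : Set} → Fam Z → (Sub Z → Sub Z) → Set₁
μSub {Z} 𝒴 μ = ∀ (X : Sub Z) → 𝒴 X → μ X ⊆ X

μPR : {Z : Set} → Fam Z → (Sub Z → Sub Z) → Set₁
μPR {Z} 𝒴 μ = ∀ (X Y : Sub Z) → 𝒴 X → 𝒴 Y → X ⊆ Y → (λ z → z ∈ μ Y × z ∈ X) ⊆ μ X

μCUM : {Z : Set} → Fam Z → (Sub Z → Sub Z) → Set₁
μCUM {Z} 𝒴 μ = ∀ (X Y : Sub Z) → 𝒴 X → 𝒴 Y → μ X ⊆ Y → Y ⊆ X → μ Y ≐ μ X

H : {Z : Set} → Fam Z → (Sub Z → Sub Z) → Sub Z → Pred Z (lsuc 0ℓ)
H {Z} 𝒴 μ U = λ z → Σ (Sub Z) (λ X → 𝒴 X × μ X ⊆ U × z ∈ X)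

module Submission where

-- The argument rests on one elementary consequence of (μ⊆) and (μPR):
-- a preferred element of a union X ∪ Y that lies in Y is preferred in Y
-- (restriction), so that μ(X ∪ Y) ⊆ μ(X) ∪ μ(Y) (splitting).
--
-- Under (μCUM) the key step is part (4): if x ∈ μ(A) ⊆ H(U), pick X ∈ 𝒴
-- with μ(X) ⊆ U and x ∈ X; splitting gives μ(A ∪ X) ⊆ A, so cumulativity
-- yields μ(A ∪ X) = μ(A), and restriction puts x into μ(X) ⊆ U.  Part (5)
-- applies (4) to A = U ∪ Y, and then cumulativity once more; (6) and (7)
-- are short consequences of (5) and (4).

open import Defs
open import Data.Product using (_×_; ∃; _,_; proj₁; proj₂)
open import Data.Sum using (inj₁; inj₂)
open import Relation.Nullary using (¬_; contradiction)
open import Relation.Unary using (_⊆_; _≐_; _∪_; _∖_; _∈_; _∉_)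

module _ {Z : Set} (𝒴 : Fam Z) (μ : Sub Z → Sub Z) where

  -- (1) μ of a union is covered by the μ's of its members: a preferred
  -- x ∈ A lies in some Aᵢ ⊆ A, and (μPR) makes it preferred there.
  μ-⋃-⊆ : μSub 𝒴 μ → μPR 𝒴 μ
    → (I : Set) (A : Sub Z) (Aᵢ : I → Sub Z) → 𝒴 A → (∀ i → 𝒴 (Aᵢ i))
    → A ≐ (λ z → ∃ (λ i → z ∈ Aᵢ i))
    → μ A ⊆ (λ z → ∃ (λ i → z ∈ μ (Aᵢ i)))
  μ-⋃-⊆ sub pr I A Aᵢ 𝒴A 𝒴Aᵢ (A⊆⋃ , ⋃⊆A) x∈μA with A⊆⋃ (sub A 𝒴A x∈μA)
  ... | i , x∈Aᵢ = i , pr (Aᵢ i) A (𝒴Aᵢ i) 𝒴A (λ z∈Aᵢ → ⋃⊆A (i , z∈Aᵢ)) (x∈μA , x∈Aᵢ)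

  ⊆-H : μSub 𝒴 μ → (U : Sub Z) → 𝒴 U → U ⊆ H 𝒴 μ U
  ⊆-H sub U 𝒴U x∈U = U , 𝒴U , sub U 𝒴U , x∈U

  H-mono : (U U′ : Sub Z) → U ⊆ U′ → H 𝒴 μ U ⊆ H 𝒴 μ U′
  H-mono U U′ U⊆U′ (X , 𝒴X , μX⊆U , x∈X) = X , 𝒴X , (λ z → U⊆U′ (μX⊆U z)) , x∈X

  module _ (uc : UnionClosed 𝒴) (pr : μPR 𝒴 μ) where

    μ-∪-restrictˡ : (X Y : Sub Z) → 𝒴 X → 𝒴 Y
      → ∀ {x} → x ∈ μ (X ∪ Y) → x ∈ X → x ∈ μ X
    μ-∪-restrictˡ X Y 𝒴X 𝒴Y x∈μ x∈X = pr X (X ∪ Y) 𝒴X (uc X Y 𝒴X 𝒴Y) inj₁ (x∈μ , x∈X)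

    μ-∪-restrictʳ : (X Y : Sub Z) → 𝒴 X → 𝒴 Y
      → ∀ {x} → x ∈ μ (X ∪ Y) → x ∈ Y → x ∈ μ Y
    μ-∪-restrictʳ X Y 𝒴X 𝒴Y x∈μ x∈Y = pr Y (X ∪ Y) 𝒴Y (uc X Y 𝒴X 𝒴Y) inj₂ (x∈μ , x∈Y)

    module _ (sub : μSub 𝒴 μ) where

      μ-∪-split : (X Y : Sub Z) → 𝒴 X → 𝒴 Y → μ (X ∪ Y) ⊆ (μ X ∪ μ Y)
      μ-∪-split X Y 𝒴X 𝒴Y x∈μ with sub (X ∪ Y) (uc X Y 𝒴X 𝒴Y) x∈μ
      ... | inj₁ x∈X = inj₁ (μ-∪-restrictˡ X Y 𝒴X 𝒴Y x∈μ x∈X)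
      ... | inj₂ x∈Y = inj₂ (μ-∪-restrictʳ X Y 𝒴X 𝒴Y x∈μ x∈Y)

      -- (3) Preferred elements of U ∪ Y outside H(U) are outside U, hence
      -- in Y, hence preferred in Y.
      μ-∪-∖H : (U Y : Sub Z) → 𝒴 U → 𝒴 Y → (μ (U ∪ Y) ∖ H 𝒴 μ U) ⊆ μ Y
      μ-∪-∖H U Y 𝒴U 𝒴Y (x∈μ , x∉H) with sub (U ∪ Y) (uc U Y 𝒴U 𝒴Y) x∈μ
      ... | inj₁ x∈U = contradiction (⊆-H sub U 𝒴U x∈U) x∉H
      ... | inj₂ x∈Y = μ-∪-restrictʳ U Y 𝒴U 𝒴Y x∈μ x∈Y

      module _ (cum : μCUM 𝒴 μ) where

        μ-∪-cum : (A X : Sub Z) → 𝒴 A → 𝒴 X → μ (A ∪ X) ⊆ A → μ A ≐ μ (A ∪ X)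
        μ-∪-cum A X 𝒴A 𝒴X μ⊆A = cum (A ∪ X) A (uc A X 𝒴A 𝒴X) 𝒴A μ⊆A inj₁

        μ-⊆-from-H : (U A : Sub Z) → 𝒴 U → 𝒴 A → U ⊆ A → μ A ⊆ H 𝒴 μ U → μ A ⊆ U
        μ-⊆-from-H U A 𝒴U 𝒴A U⊆A μA⊆H x∈μA with μA⊆H x∈μA
        ... | X , 𝒴X , μX⊆U , x∈X =
          μX⊆U (μ-∪-restrictʳ A X 𝒴A 𝒴X (proj₁ μA≐ x∈μA) x∈X)
          where
          μ∪⊆A : μ (A ∪ X) ⊆ A
          μ∪⊆A z∈μ with μ-∪-split A X 𝒴A 𝒴X z∈μ
          ... | inj₁ z∈μA = sub A 𝒴A z∈μA
          ... | inj₂ z∈μX = U⊆A (μX⊆U z∈μX)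

          μA≐ : μ A ≐ μ (A ∪ X)
          μA≐ = μ-∪-cum A X 𝒴A 𝒴X μ∪⊆A

        μ-∪-⊆-from-H : (U Y : Sub Z) → 𝒴 U → 𝒴 Y → μ (U ∪ Y) ⊆ H 𝒴 μ U → μ (U ∪ Y) ⊆ U
        μ-∪-⊆-from-H U Y 𝒴U 𝒴Y = μ-⊆-from-H U (U ∪ Y) 𝒴U (uc U Y 𝒴U 𝒴Y) inj₁

        -- (5) If μ(Y) ⊆ H(U), then U ∪ Y witnesses Y ⊆ H(U), and
        -- μ(U ∪ Y) = μ(U).
        H-absorbs : (U Y : Sub Z) → 𝒴 U → 𝒴 Y → μ Y ⊆ H 𝒴 μ U
          → (Y ⊆ H 𝒴 μ U) × (μ (U ∪ Y) ≐ μ U)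
        H-absorbs U Y 𝒴U 𝒴Y μY⊆H =
          (λ x∈Y → U ∪ Y , uc U Y 𝒴U 𝒴Y , μ∪⊆U , inj₂ x∈Y) , (proj₂ μU≐ , proj₁ μU≐)
          where
          μ∪⊆H : μ (U ∪ Y) ⊆ H 𝒴 μ U
          μ∪⊆H z∈μ with μ-∪-split U Y 𝒴U 𝒴Y z∈μ
          ... | inj₁ z∈μU = ⊆-H sub U 𝒴U (sub U 𝒴U z∈μU)
          ... | inj₂ z∈μY = μY⊆H z∈μY

          μ∪⊆U : μ (U ∪ Y) ⊆ U
          μ∪⊆U = μ-∪-⊆-from-H U Y 𝒴U 𝒴Y μ∪⊆H

          μU≐ : μ U ≐ μ (U ∪ Y)
          μU≐ = μ-∪-cum U Y 𝒴U 𝒴Y μ∪⊆U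

        -- (6) If Y ⊆ H(U), then by (5) μ(U) = μ(U ∪ Y), so an x ∈ μ(U) ∩ Y
        -- would be preferred in Y.
        ⊈-H-witness : (U Y : Sub Z) (x : Z) → 𝒴 U → 𝒴 Y → x ∈ μ U → x ∈ Y → x ∉ μ Y
          → ¬ (Y ⊆ H 𝒴 μ U)
        ⊈-H-witness U Y x 𝒴U 𝒴Y x∈μU x∈Y x∉μY Y⊆H =
          x∉μY (μ-∪-restrictʳ U Y 𝒴U 𝒴Y (proj₂ μ∪≐μU x∈μU) x∈Y)
          where
          μ∪≐μU : μ (U ∪ Y) ≐ μ U
          μ∪≐μU = proj₂ (H-absorbs U Y 𝒴U 𝒴Y (λ z∈μY → Y⊆H (sub Y 𝒴Y z∈μY)))

        -- (7) If μ(U ∪ Y) ⊆ H(U), then μ(U ∪ Y) ⊆ U by (4), so U ∪ Y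
        -- witnesses Y ⊆ H(U).
        ⊈-H-∪ : (U Y : Sub Z) → 𝒴 U → 𝒴 Y → ¬ (Y ⊆ H 𝒴 μ U) → ¬ (μ (U ∪ Y) ⊆ H 𝒴 μ U)
        ⊈-H-∪ U Y 𝒴U 𝒴Y Y⊈H μ∪⊆H =
          Y⊈H (λ x∈Y → U ∪ Y , uc U Y 𝒴U 𝒴Y , μ-∪-⊆-from-H U Y 𝒴U 𝒴Y μ∪⊆H , inj₂ x∈Y)

fact3p15 : (Z : Set) (𝒴 : Fam Z) (μ : Sub Z → Sub Z)
    → FamExt 𝒴 → UnionClosed 𝒴 → μExt 𝒴 μ
    → μSub 𝒴 μ → μPR 𝒴 μ
    → ((I : Set) (A : Sub Z) (Aᵢ : I → Sub Z) → 𝒴 A → (∀ i → 𝒴 (Aᵢ i))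
         → A ≐ (λ z → ∃ (λ i → z ∈ Aᵢ i))
         → μ A ⊆ (λ z → ∃ (λ i → z ∈ μ (Aᵢ i))))
      × ((U : Sub Z) → 𝒴 U → U ⊆ H 𝒴 μ U)
      × ((U U′ : Sub Z) → 𝒴 U → 𝒴 U′ → U ⊆ U′ → H 𝒴 μ U ⊆ H 𝒴 μ U′)
      × ((U Y : Sub Z) → 𝒴 U → 𝒴 Y → (μ (U ∪ Y) ∖ H 𝒴 μ U) ⊆ μ Y)
      × (μCUM 𝒴 μ
         → ((U A : Sub Z) → 𝒴 U → 𝒴 A → U ⊆ A → μ A ⊆ H 𝒴 μ U → μ A ⊆ U)
         × ((U Y : Sub Z) → 𝒴 U → 𝒴 Y → μ Y ⊆ H 𝒴 μ U
              → (Y ⊆ H 𝒴 μ U) × (μ (U ∪ Y) ≐ μ U))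
         × ((U Y : Sub Z) (x : Z) → 𝒴 U → 𝒴 Y → x ∈ μ U → x ∈ Y → x ∉ μ Y
              → ¬ (Y ⊆ H 𝒴 μ U))
         × ((U Y : Sub Z) → 𝒴 U → 𝒴 Y → ¬ (Y ⊆ H 𝒴 μ U)
              → ¬ (μ (U ∪ Y) ⊆ H 𝒴 μ U)))
fact3p15 Z 𝒴 μ _ uc _ sub pr =
    μ-⋃-⊆ 𝒴 μ sub pr
  , ⊆-H 𝒴 μ sub
  , (λ U U′ _ _ → H-mono 𝒴 μ U U′)
  , μ-∪-∖H 𝒴 μ uc pr sub
  , λ cum → μ-⊆-from-H 𝒴 μ uc pr sub cum
          , H-absorbs 𝒴 μ uc pr sub cum
          , ⊈-H-witness 𝒴 μ uc pr sub cum
          , ⊈-H-∪ 𝒴 μ uc pr sub cum
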